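{- Let $G=(V,E)$ be a graph and $k\ge 1$. Let $X$ be a feasible solution for $(G,k)$ and let $P=\{v_1,v_2,v_3\}\subseteq V_{\mathrm{ld}}$ induce a $P_3$. Then $X\cap P\neq\emptyset$.
   Context: Graphs are undirected, without self-loops, possibly with multi-edges. $N(v)$ is the neighbor set; $\rho(v)$ is the number of unordered pairs of neighbors of $v$ that are adjacent (parallel edges counted once). $V_{\mathrm{ld}}$ is the set of vertices $v$ with $|N(v)|>7k$ and $\rho(v)>|N(v)|(|N(v)|-1)/4$. A triple $(v_1,v_2,v_3)$ of distinct vertices induces a $P_3$ if $v_1v_2\in E$, $v_2v_3\in E$ and $v_1v_3\notin E$ (the edges $v_1v_2$, $v_2v_3$ may be multi-edges). A feasible solution for $(G,k)$ is $X\subseteq V$ with $|X|\le k$ such that every component of $G-X$ is a clique (exactly one edge between any two distinct vertices) or a tree (connected, acyclic, where parallel edges form a cycle). -}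

module Defs where

open import Data.Nat using (ℕ; zero; suc; _+_; _*_; _∸_; _≤_; _<_; _>_)
open import Data.Fin using (Fin; zero; suc; inject₁; fromℕ) renaming (_<_ to _<ᶠ_; _≟_ to _≟ᶠ_; _<?_ to _<?ᶠ_)
open import Data.Fin.Properties using (any?)
open import Data.Fin.Subset using (Subset; _∈_; _∉_; ∣_∣)
open import Data.List using (List; length; filter; cartesianProduct)
open import Data.List.Base using (allFin)
open import Data.Product using (Σ; ∃; _×_; _,_; proj₁; proj₂)
open import Data.Sum using (_⊎_; inj₁; inj₂)
open import Data.Empty using (⊥)
open import Function using (Injective)
open import Relation.Nullary using (¬_; Dec; yes; no)
open import Relation.Nullary.Decidable using (_×-dec_; _⊎-dec_)
open import Relation.Binary.PropositionalEquality using (_≡_; _≢_)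

-- A finite multigraph without self-loops: vertices Fin n, edges Fin nE,
-- each edge has two (distinct) endpoints.  Parallel edges are allowed.
record Graph (n : ℕ) : Set where
  field
    nE       : ℕ
    ends     : Fin nE → Fin n × Fin n
    loopless : ∀ e → proj₁ (ends e) ≢ proj₂ (ends e)
open Graph public

module _ {n : ℕ} (G : Graph n) where

  Joins : Fin (nE G) → Fin n → Fin n → Set
  Joins e u w = (proj₁ (ends G e) ≡ u × proj₂ (ends G e) ≡ w)
              ⊎ (proj₁ (ends G e) ≡ w × proj₂ (ends G e) ≡ u)

  joins? : ∀ e u w → Dec (Joins e u w)
  joins? e u w = ((proj₁ (ends G e) ≟ᶠ u) ×-dec (proj₂ (ends G e) ≟ᶠ w))
          ⊎-dec ((proj₁ (ends G e) ≟ᶠ w) ×-dec (proj₂ (ends G e) ≟ᶠ u))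

  Adj : Fin n → Fin n → Set
  Adj u w = ∃ λ e → Joins e u w

  adj? : ∀ u w → Dec (Adj u w)
  adj? u w = any? (λ e → joins? e u w)

  edgeCount : Fin n → Fin n → ℕ
  edgeCount u w = length (filter (λ e → joins? e u w) (allFin (nE G)))

  deg : Fin n → ℕ
  deg v = length (filter (λ u → adj? v u) (allFin n))

  -- ρ(v): unordered pairs {u,w} (counted once via u < w) of neighbours of v that are adjacent
  PairAt : Fin n → Fin n × Fin n → Set
  PairAt v (u , w) = u <ᶠ w × Adj v u × Adj v w × Adj u w

  pairAt? : ∀ v p → Dec (PairAt v p)
  pairAt? v (u , w) = (u <?ᶠ w) ×-dec (adj? v u ×-dec (adj? v w ×-dec adj? u w))

  ρ : Fin n → ℕ
  ρ v = length (filter (pairAt? v) (cartesianProduct (allFin n) (allFin n)))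

  -- v ∈ V_ld  (ρ(v) > d(d-1)/4 written as 4ρ(v) > d(d-1), d = |N(v)|)
  InVld : ℕ → Fin n → Set
  InVld k v = deg v > 7 * k × 4 * ρ v > deg v * (deg v ∸ 1)

  InducesP3 : Fin n → Fin n → Fin n → Set
  InducesP3 v₁ v₂ v₃ = v₁ ≢ v₂ × v₂ ≢ v₃ × v₁ ≢ v₃
                     × Adj v₁ v₂ × Adj v₂ v₃ × ¬ Adj v₁ v₃

  data Reach (X : Subset n) (v : Fin n) : Fin n → Set where
    here : v ∉ X → Reach X v v
    step : ∀ {u w} → Reach X v u → Adj u w → w ∉ X → Reach X v w

  CliqueComp : Subset n → Fin n → Set
  CliqueComp X v = ∀ u w → Reach X v u → Reach X v w → u ≢ w → edgeCount u w ≡ 1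

  -- a cycle of length suc m ≥ 2 inside the component of v in G - X:
  -- pairwise distinct vertices, pairwise distinct edges, consecutive (cyclically) joined.
  record CycleIn (X : Subset n) (v : Fin n) : Set where
    field
      m      : ℕ
      m≥1    : 1 ≤ m
      vs     : Fin (suc m) → Fin n
      es     : Fin (suc m) → Fin (nE G)
      vsInj  : Injective _≡_ _≡_ vs
      esInj  : Injective _≡_ _≡_ es
      inComp : ∀ i → Reach X v (vs i)
      link   : ∀ (i : Fin m) → Joins (es (inject₁ i)) (vs (inject₁ i)) (vs (suc i))
      close  : Joins (es (fromℕ m)) (vs (fromℕ m)) (vs zero)

  -- the component of v in G - X is a tree (connected by construction, acyclic)
  TreeComp : Subset n → Fin n → Set
  TreeComp X v = ¬ CycleIn X v

  Feasible : ℕ → Subset n → Set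
  Feasible k X = ∣ X ∣ ≤ k × (∀ v → v ∉ X → CliqueComp X v ⊎ TreeComp X v)

{-# OPTIONS --safe #-}
-- If P avoids X, then v₁, v₂, v₃ lie in one component of G − X, which is no
-- clique since v₁v₃ ∉ E, hence must be a tree.  But a set X of at most k
-- vertices meets at most k·|N(v₁)| of the ρ(v₁) adjacent pairs of neighbours
-- of v₁ (charge each pair to an endpoint in X), and ρ(v₁) > |N(v₁)|(|N(v₁)|−1)/4
-- exceeds that because |N(v₁)| > 7k ≥ 4k.  So some adjacent pair of neighbours
-- avoids X and closes a triangle through v₁ in G − X.
module Submission where

open import Defs
open import Data.Nat using (ℕ; _≤_)
open import Data.Fin using (Fin)
open import Data.Fin.Subset using (Subset; _∈_)
open import Data.Sum using (_⊎_)

open import Level using (Level)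
open import Data.Bool using (if_then_else_)
open import Data.Nat using (zero; suc; _+_; _*_; _∸_; _<_; z≤n; s≤s)
open import Data.Nat.Properties
open import Algebra.Properties.Semiring.Sum +-*-semiring
  using (sum; sum-syntax; sum-cong-≗; ∑-distrib-+; ∑-comm; *-distribˡ-sum; *-distribʳ-sum)
open import Data.Fin using (zero; suc) renaming (_<_ to _<ᶠ_)
import Data.Fin.Properties as Fin
open import Data.Fin.Subset using (_∉_; ∣_∣; inside; outside)
open import Data.Fin.Subset.Properties using (_∈?_)
open import Data.Vec using ([]; _∷_; lookup)
open import Data.List using ([]; _∷_; allFin; length; filter; cartesianProduct; map; tabulate; _++_)
open import Data.List.Properties using (filter-++; length-++; map-tabulate)
open import Data.Product using (∃; ∃₂; _×_; _,_; proj₁; proj₂)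
open import Data.Sum using (inj₁; inj₂; [_,_]′)
open import Data.Empty using (⊥-elim)
open import Function using (_∘_; id; Injective)
open import Relation.Nullary using (¬_; Dec; yes; no; does; contradiction)
open import Relation.Nullary.Decidable using (_×-dec_; ¬?)
open import Relation.Unary using (Pred; Decidable)
open import Relation.Binary.PropositionalEquality
  using (_≡_; _≢_; refl; sym; trans; cong; cong₂; subst₂; module ≡-Reasoning)

private
  variable
    a b p q : Level
    A : Set a
    B : Set b

𝟙 : Dec A → ℕ
𝟙 d = if does d then 1 else 0

sum-mono-≤ : ∀ {n} {f g : Fin n → ℕ} → (∀ i → f i ≤ g i) → sum f ≤ sum g
sum-mono-≤ {zero}  _   = z≤n
sum-mono-≤ {suc n} f≤g = +-mono-≤ (f≤g zero) (sum-mono-≤ (f≤g ∘ suc))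

length-filter-tabulate : ∀ {P : Pred A p} (P? : Decidable P) {n} (f : Fin n → A) →
  length (filter P? (tabulate f)) ≡ ∑[ i < n ] 𝟙 (P? (f i))
length-filter-tabulate P? {zero}  f = refl
length-filter-tabulate P? {suc n} f with P? (f zero)
... | yes _ = cong suc (length-filter-tabulate P? (f ∘ suc))
... | no _  = length-filter-tabulate P? (f ∘ suc)

length-filter-cartesianProduct : ∀ {P : Pred (A × B) p} (P? : Decidable P) {m n}
  (f : Fin m → A) (g : Fin n → B) →
  length (filter P? (cartesianProduct (tabulate f) (tabulate g)))
    ≡ ∑[ i < m ] ∑[ j < n ] 𝟙 (P? (f i , g j))
length-filter-cartesianProduct P? {zero}  f g = refl
length-filter-cartesianProduct P? {suc m} {n} f g = begin
  length (filter P? (map (f zero ,_) (tabulate g) ++ rest))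
    ≡⟨ cong length (filter-++ P? (map (f zero ,_) (tabulate g)) rest) ⟩
  length (filter P? (map (f zero ,_) (tabulate g)) ++ filter P? rest)
    ≡⟨ length-++ (filter P? (map (f zero ,_) (tabulate g))) ⟩
  length (filter P? (map (f zero ,_) (tabulate g))) + length (filter P? rest)
    ≡⟨ cong₂ _+_ first-row (length-filter-cartesianProduct P? (f ∘ suc) g) ⟩
  ∑[ j < n ] 𝟙 (P? (f zero , g j)) + ∑[ i < m ] ∑[ j < n ] 𝟙 (P? (f (suc i) , g j))
    ∎
  where
  open ≡-Reasoning
  rest = cartesianProduct (tabulate (f ∘ suc)) (tabulate g)
  first-row : length (filter P? (map (f zero ,_) (tabulate g))) ≡ ∑[ j < n ] 𝟙 (P? (f zero , g j))
  first-row = trans (cong (length ∘ filter P?) (map-tabulate g (f zero ,_)))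
                    (length-filter-tabulate P? ((f zero ,_) ∘ g))

∣p∣≡∑𝟙∈ : ∀ {n} (p : Subset n) → ∣ p ∣ ≡ ∑[ i < n ] 𝟙 (i ∈? p)
∣p∣≡∑𝟙∈ []            = refl
∣p∣≡∑𝟙∈ (inside  ∷ p) = cong suc (∣p∣≡∑𝟙∈ p)
∣p∣≡∑𝟙∈ (outside ∷ p) = ∣p∣≡∑𝟙∈ p

-- Each pair is charged to its endpoints in X; as u < w, a vertex x ∈ X is
-- charged at most once for each y ∈ N.
module _ {n} {N : Pred (Fin n) p} {E : Pred (Fin n × Fin n) q}
         (N? : Decidable N) (E? : Decidable E)
         (pair-in-N : ∀ {u w} → E (u , w) → u <ᶠ w × N u × N w) (X : Subset n)
         (X-covers : ∀ {u w} → E (u , w) → u ∈ X ⊎ w ∈ X) where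

  private
    e : Fin n → Fin n → ℕ
    e u w = 𝟙 (E? (u , w))
    χ : Fin n → ℕ
    χ x = 𝟙 (x ∈? X)

  e≤charged : ∀ u w → e u w ≤ χ u * e u w + χ w * e u w
  e≤charged u w with E? (u , w) | u ∈? X | w ∈? X
  ... | no _  | _      | _      = z≤n
  ... | yes _ | yes _  | _      = s≤s z≤n
  ... | yes _ | no _   | yes _  = s≤s z≤n
  ... | yes uw | no u∉X | no w∉X = ⊥-elim ([ u∉X , w∉X ]′ (X-covers uw))

  e+e˘≤𝟙N : ∀ x y → e x y + e y x ≤ 𝟙 (N? y)
  e+e˘≤𝟙N x y with E? (x , y) | E? (y , x) | N? y
  ... | yes xy | yes yx | _      = ⊥-elim (Fin.<-asym (proj₁ (pair-in-N xy)) (proj₁ (pair-in-N yx)))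
  ... | yes _  | no _   | yes _  = s≤s z≤n
  ... | yes xy | no _   | no ¬Ny = contradiction (proj₂ (proj₂ (pair-in-N xy))) ¬Ny
  ... | no _   | yes _  | yes _  = s≤s z≤n
  ... | no _   | yes yx | no ¬Ny = contradiction (proj₁ (proj₂ (pair-in-N yx))) ¬Ny
  ... | no _   | no _   | _      = z≤n

  ∑∑𝟙E≤∣X∣*∑𝟙N : ∑[ u < n ] ∑[ w < n ] 𝟙 (E? (u , w)) ≤ ∣ X ∣ * ∑[ w < n ] 𝟙 (N? w)
  ∑∑𝟙E≤∣X∣*∑𝟙N = begin
    ∑[ u < n ] ∑[ w < n ] e u w
      ≤⟨ sum-mono-≤ (λ u → sum-mono-≤ (e≤charged u)) ⟩
    ∑[ u < n ] ∑[ w < n ] (χ u * e u w + χ w * e u w)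
      ≡⟨ sum-cong-≗ (λ u → ∑-distrib-+ (λ w → χ u * e u w) (λ w → χ w * e u w)) ⟩
    ∑[ u < n ] (∑[ w < n ] (χ u * e u w) + ∑[ w < n ] (χ w * e u w))
      ≡⟨ ∑-distrib-+ (λ u → ∑[ w < n ] (χ u * e u w)) (λ u → ∑[ w < n ] (χ w * e u w)) ⟩
    ∑[ u < n ] ∑[ w < n ] (χ u * e u w) + ∑[ u < n ] ∑[ w < n ] (χ w * e u w)
      ≡⟨ cong (∑[ u < n ] ∑[ w < n ] (χ u * e u w) +_) (∑-comm (λ u w → χ w * e u w)) ⟩
    ∑[ x < n ] ∑[ y < n ] (χ x * e x y) + ∑[ x < n ] ∑[ y < n ] (χ x * e y x)
      ≡⟨ ∑-distrib-+ (λ x → ∑[ y < n ] (χ x * e x y)) (λ x → ∑[ y < n ] (χ x * e y x)) ⟨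
    ∑[ x < n ] (∑[ y < n ] (χ x * e x y) + ∑[ y < n ] (χ x * e y x))
      ≡⟨ sum-cong-≗ (λ x → cong₂ _+_ (*-distribˡ-sum (χ x) (e x))
                                     (*-distribˡ-sum (χ x) (λ y → e y x))) ⟨
    ∑[ x < n ] (χ x * ∑[ y < n ] e x y + χ x * ∑[ y < n ] e y x)
      ≡⟨ sum-cong-≗ (λ x → trans (cong (χ x *_) (∑-distrib-+ (e x) (λ y → e y x)))
                                 (*-distribˡ-+ (χ x) _ _)) ⟨
    ∑[ x < n ] (χ x * ∑[ y < n ] (e x y + e y x))
      ≤⟨ sum-mono-≤ (λ x → *-monoʳ-≤ (χ x) (sum-mono-≤ (e+e˘≤𝟙N x))) ⟩
    ∑[ x < n ] (χ x * ∑[ y < n ] 𝟙 (N? y))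
      ≡⟨ *-distribʳ-sum (∑[ y < n ] 𝟙 (N? y)) χ ⟨
    (∑[ x < n ] χ x) * ∑[ y < n ] 𝟙 (N? y)
      ≡⟨ cong (_* ∑[ y < n ] 𝟙 (N? y)) (∣p∣≡∑𝟙∈ X) ⟨
    ∣ X ∣ * ∑[ y < n ] 𝟙 (N? y)
      ∎
    where open ≤-Reasoning

filter-nonempty⇒∃ : ∀ {P : Pred A p} (P? : Decidable P) xs → 0 < length (filter P? xs) → ∃ P
filter-nonempty⇒∃ P? []       ()
filter-nonempty⇒∃ P? (x ∷ xs) nonempty with P? x
... | yes px = x , px
... | no _   = filter-nonempty⇒∃ P? xs nonempty

m*[m∸1]<4*[k*m]⇒m≤4*k : ∀ k m → m * (m ∸ 1) < 4 * (k * m) → m ≤ 4 * k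
m*[m∸1]<4*[k*m]⇒m≤4*k k zero    _  = z≤n
m*[m∸1]<4*[k*m]⇒m≤4*k k (suc m) lt =
  *-cancelʳ-< (suc m) m (4 * k) (subst₂ _<_ (*-comm (suc m) m) (sym (*-assoc 4 k (suc m))) lt)

triple-injective : ∀ {x y z : A} → x ≢ y → y ≢ z → x ≢ z →
                   Injective _≡_ _≡_ (lookup (x ∷ y ∷ z ∷ []))
triple-injective x≢y y≢z x≢z {zero}           {zero}           _  = refl
triple-injective x≢y y≢z x≢z {zero}           {suc zero}       eq = contradiction eq x≢y
triple-injective x≢y y≢z x≢z {zero}           {suc (suc zero)} eq = contradiction eq x≢z
triple-injective x≢y y≢z x≢z {suc zero}       {zero}           eq = contradiction (sym eq) x≢y
triple-injective x≢y y≢z x≢z {suc zero}       {suc zero}       _  = refl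
triple-injective x≢y y≢z x≢z {suc zero}       {suc (suc zero)} eq = contradiction eq y≢z
triple-injective x≢y y≢z x≢z {suc (suc zero)} {zero}           eq = contradiction (sym eq) x≢z
triple-injective x≢y y≢z x≢z {suc (suc zero)} {suc zero}       eq = contradiction (sym eq) y≢z
triple-injective x≢y y≢z x≢z {suc (suc zero)} {suc (suc zero)} _  = refl

module _ {n} (G : Graph n) where

  joins-sym : ∀ {e u w} → Joins G e u w → Joins G e w u
  joins-sym (inj₁ ends≡) = inj₂ ends≡
  joins-sym (inj₂ ends≡) = inj₁ ends≡

  joins-endpoint : ∀ {e a b c d} → Joins G e a b → Joins G e c d → a ≡ c ⊎ a ≡ d
  joins-endpoint (inj₁ (p , _)) (inj₁ (q , _)) = inj₁ (trans (sym p) q)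
  joins-endpoint (inj₁ (p , _)) (inj₂ (q , _)) = inj₂ (trans (sym p) q)
  joins-endpoint (inj₂ (_ , p)) (inj₁ (_ , q)) = inj₂ (trans (sym p) q)
  joins-endpoint (inj₂ (_ , p)) (inj₂ (_ , q)) = inj₁ (trans (sym p) q)

  joins-distinct : ∀ {e e′ a b c d} → Joins G e a b → Joins G e′ c d → a ≢ c → a ≢ d → e ≢ e′
  joins-distinct ab cd a≢c a≢d refl = [ a≢c , a≢d ]′ (joins-endpoint ab cd)

  adj⇒≢ : ∀ {u w} → Adj G u w → u ≢ w
  adj⇒≢ (e , inj₁ (p , q)) u≡w = loopless G e (trans p (trans u≡w (sym q)))
  adj⇒≢ (e , inj₂ (p , q)) u≡w = loopless G e (trans p (trans (sym u≡w) (sym q)))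

  edgeCount≡1⇒adj : ∀ u w → edgeCount G u w ≡ 1 → Adj G u w
  edgeCount≡1⇒adj u w count≡1 =
    filter-nonempty⇒∃ (λ e → joins? G e u w) (allFin (nE G)) (≤-reflexive (sym count≡1))

  triangle⇒CycleIn : ∀ {X v u w} → v ∉ X → u ∉ X → w ∉ X →
    Adj G v u → Adj G u w → Adj G v w → u ≢ w → CycleIn G X v
  triangle⇒CycleIn v∉X u∉X w∉X (e₁ , vu) (e₂ , uw) (e₃ , vw) u≢w = record
    { m      = 2
    ; m≥1    = s≤s z≤n
    ; vs     = lookup (_ ∷ _ ∷ _ ∷ [])
    ; es     = lookup (e₁ ∷ e₂ ∷ e₃ ∷ [])
    ; vsInj  = triple-injective v≢u u≢w v≢w
    ; esInj  = triple-injective (joins-distinct vu uw v≢u v≢w)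
                                (joins-distinct uw vw (v≢u ∘ sym) u≢w)
                                (joins-distinct (joins-sym vu) vw (v≢u ∘ sym) u≢w)
    ; inComp = λ { zero             → here v∉X
                 ; (suc zero)       → step (here v∉X) (e₁ , vu) u∉X
                 ; (suc (suc zero)) → step (here v∉X) (e₃ , vw) w∉X }
    ; link   = λ { zero → vu ; (suc zero) → uw }
    ; close  = joins-sym vw
    }
    where
    v≢u = adj⇒≢ (e₁ , vu)
    v≢w = adj⇒≢ (e₃ , vw)

  ρ≤∣X∣*deg : ∀ v (X : Subset n) → (∀ {u w} → PairAt G v (u , w) → u ∈ X ⊎ w ∈ X) →
    ρ G v ≤ ∣ X ∣ * deg G v
  ρ≤∣X∣*deg v X X-covers = begin
    ρ G v
      ≡⟨ length-filter-cartesianProduct (pairAt? G v) id id ⟩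
    ∑[ u < n ] ∑[ w < n ] 𝟙 (pairAt? G v (u , w))
      ≤⟨ ∑∑𝟙E≤∣X∣*∑𝟙N (adj? G v) (pairAt? G v) (λ (u<w , vu , vw , _) → u<w , vu , vw)
                       X X-covers ⟩
    ∣ X ∣ * ∑[ w < n ] 𝟙 (adj? G v w)
      ≡⟨ cong (∣ X ∣ *_) (length-filter-tabulate (adj? G v) id) ⟨
    ∣ X ∣ * deg G v
      ∎
    where open ≤-Reasoning

  uncovered-pair : ∀ {k v} (X : Subset n) → ∣ X ∣ ≤ k → InVld G k v →
    ∃₂ λ u w → PairAt G v (u , w) × u ∉ X × w ∉ X
  uncovered-pair {k} {v} X ∣X∣≤k (7k<deg , deg*[deg∸1]<4ρ)
    with Fin.any? (λ u → Fin.any? (λ w → pairAt? G v (u , w) ×-dec ¬? (u ∈? X) ×-dec ¬? (w ∈? X)))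
  ... | yes (u , w , pair) = u , w , pair
  ... | no ∄uncovered = ⊥-elim (<⇒≱ 7k<deg (≤-trans deg≤4k (*-monoˡ-≤ k (m≤m+n 4 3))))
    where
    X-covers : ∀ {u w} → PairAt G v (u , w) → u ∈ X ⊎ w ∈ X
    X-covers {u} {w} uw with u ∈? X | w ∈? X
    ... | yes u∈X | _       = inj₁ u∈X
    ... | no _    | yes w∈X = inj₂ w∈X
    ... | no u∉X  | no w∉X  = contradiction (u , w , uw , u∉X , w∉X) ∄uncovered
    ρ≤k*deg : ρ G v ≤ k * deg G v
    ρ≤k*deg = ≤-trans (ρ≤∣X∣*deg v X X-covers) (*-monoˡ-≤ (deg G v) ∣X∣≤k)
    deg≤4k : deg G v ≤ 4 * k
    deg≤4k = m*[m∸1]<4*[k*m]⇒m≤4*k k (deg G v)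
               (<-≤-trans deg*[deg∸1]<4ρ (*-monoʳ-≤ 4 ρ≤k*deg))

  InVld⇒CycleIn : ∀ {k X v} → ∣ X ∣ ≤ k → v ∉ X → InVld G k v → CycleIn G X v
  InVld⇒CycleIn {X = X} ∣X∣≤k v∉X v∈Vld with uncovered-pair X ∣X∣≤k v∈Vld
  ... | u , w , (u<w , vu , vw , uw) , u∉X , w∉X =
    triangle⇒CycleIn v∉X u∉X w∉X vu uw vw (Fin.<⇒≢ u<w)

  InducesP3⇒¬CliqueComp : ∀ {X v₁ v₂ v₃} → v₁ ∉ X → v₂ ∉ X → v₃ ∉ X →
    InducesP3 G v₁ v₂ v₃ → ¬ CliqueComp G X v₁
  InducesP3⇒¬CliqueComp v₁∉X v₂∉X v₃∉X (_ , _ , v₁≢v₃ , v₁v₂ , v₂v₃ , ¬v₁v₃) clique =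
    ¬v₁v₃ (edgeCount≡1⇒adj _ _ (clique _ _ (here v₁∉X) v₃-reachable v₁≢v₃))
    where v₃-reachable = step (step (here v₁∉X) v₁v₂ v₂∉X) v₂v₃ v₃∉X

lemma16 : ∀ {n} (G : Graph n) (k : ℕ) → 1 ≤ k → (X : Subset n) → Feasible G k X →
    (v₁ v₂ v₃ : Fin n) → InVld G k v₁ → InVld G k v₂ → InVld G k v₃ →
    InducesP3 G v₁ v₂ v₃ → v₁ ∈ X ⊎ v₂ ∈ X ⊎ v₃ ∈ X
lemma16 G k _ X (∣X∣≤k , component) v₁ v₂ v₃ v₁∈Vld _ _ p3
  with v₁ ∈? X | v₂ ∈? X | v₃ ∈? X
... | yes v₁∈X | _        | _        = inj₁ v₁∈X
... | no _     | yes v₂∈X | _        = inj₂ (inj₁ v₂∈X)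
... | no _     | no _     | yes v₃∈X = inj₂ (inj₂ v₃∈X)
... | no v₁∉X  | no v₂∉X  | no v₃∉X  =
  ⊥-elim ([ InducesP3⇒¬CliqueComp G v₁∉X v₂∉X v₃∉X p3
          , (λ tree → tree (InVld⇒CycleIn G ∣X∣≤k v₁∉X v₁∈Vld)) ]′ (component v₁ v₁∉X))
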